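{- Let $k,p,q$ be fixed nonnegative integers, and for each $n$ let $\mathcal{F}=\mathcal{F}_n\subseteq\binom{[n]}{k}$ be an intersecting family. If $\tau(\mathcal{F})\le q$, then $\beta_{p,q}(\mathcal{F})=0$. If $\tau(\mathcal{F})>q$, then $\beta_{p,q}(\mathcal{F})=O(n^{k-p-\tau(\mathcal{F})})$, where the implied constant depends only on $k,p,q$ (and the bound holds for all sufficiently large $n$).
   Context: $[n]=\{1,\dots,n\}$ and $\binom{[n]}{k}$ is the family of all $k$-subsets of $[n]$. A family $\mathcal{F}$ of sets is intersecting if $F\cap F'\neq\emptyset$ for all $F,F'\in\mathcal{F}$. For a family $\mathcal{F}$ and disjoint sets $A,B$, let $\mathcal{F}(A,\overline{B})=\{F\in\mathcal{F}: A\subseteq F,\ B\cap F=\emptyset\}$. For $\mathcal{F}\subseteq 2^{[n]}$, the $(p,q)$-dömdödöm is $\beta_{p,q}(\mathcal{F})=\min\{|\mathcal{F}(A,\overline{B})|: |A|=p,\ |B|=q,\ A\cap B=\emptyset,\ A,B\subseteq[n]\}$. The covering number $\tau(\mathcal{F})$ is the minimum size of a set $X$ with $X\cap F\neq\emptyset$ for every $F\in\mathcal{F}$. -}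

module Defs where

open import Data.Nat using (ℕ; zero; suc; _⊓_; _≟_)
open import Data.Bool using (Bool; T; T?)
open import Data.List using (List; []; _∷_; map; filter; length; foldr; cartesianProduct; _++_)
open import Data.Product using (_×_; _,_; proj₁; proj₂)
open import Data.Vec using (_∷_; [])
open import Data.Fin using (Fin)
open import Relation.Binary.PropositionalEquality using (_≡_)
open import Data.Fin.Subset using (Subset; _∈_; _∩_; _⊆_; ∣_∣; Nonempty; Empty; inside; outside)
open import Data.Fin.Subset.Properties using (_⊆?_; nonempty?)
open import Relation.Nullary using (¬_; ¬?; Dec)
open import Relation.Nullary.Decidable using (_×-dec_; _→-dec_; map′)

Family : ℕ → Set
Family n = Subset n → Bool

_∈F_ : ∀ {n} → Subset n → Family n → Set
S ∈F 𝓕 = T (𝓕 S)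

IsUniform : ∀ {n} → ℕ → Family n → Set
IsUniform k 𝓕 = ∀ S → S ∈F 𝓕 → ∣ S ∣ ≡ k

Intersecting : ∀ {n} → Family n → Set
Intersecting 𝓕 = ∀ F F' → F ∈F 𝓕 → F' ∈F 𝓕 → Nonempty (F ∩ F')

allSubsets : (n : ℕ) → List (Subset n)
allSubsets zero = [] ∷ []
allSubsets (suc n) = map (inside ∷_) (allSubsets n) ++ map (outside ∷_) (allSubsets n)

-- minimum of a list of naturals (only ever applied to nonempty lists below
-- where it matters; the empty list gets the dummy value 0)
minimumℕ : List ℕ → ℕ
minimumℕ [] = 0
minimumℕ (x ∷ xs) = foldr _⊓_ x xs

countAB : ∀ {n} → Family n → Subset n → Subset n → ℕ
countAB {n} 𝓕 A B =
  length (filter (λ F → T? (𝓕 F) ×-dec (A ⊆? F) ×-dec ¬? (nonempty? (B ∩ F))) (allSubsets n))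

admissiblePairs : (n p q : ℕ) → List (Subset n × Subset n)
admissiblePairs n p q =
  filter (λ AB → (∣ proj₁ AB ∣ ≟ p) ×-dec (∣ proj₂ AB ∣ ≟ q) ×-dec ¬? (nonempty? (proj₁ AB ∩ proj₂ AB)))
         (cartesianProduct (allSubsets n) (allSubsets n))

-- the (p,q)-dömdödöm β_{p,q}(𝓕) (min over admissible pairs; these exist iff p + q ≤ n)
β : ∀ {n} → ℕ → ℕ → Family n → ℕ
β {n} p q 𝓕 = minimumℕ (map (λ AB → countAB 𝓕 (proj₁ AB) (proj₂ AB)) (admissiblePairs n p q))

Covers : ∀ {n} → Subset n → Family n → Set
Covers X 𝓕 = ∀ F → F ∈F 𝓕 → Nonempty (X ∩ F)

allSubset? : ∀ {n} {P : Subset n → Set} → (∀ S → Dec (P S)) → Dec (∀ S → P S)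
allSubset? {zero} P? = map′ (λ p → λ { [] → p }) (λ f → f []) (P? [])
allSubset? {suc n} P? =
  map′ (λ fg → λ { (inside ∷ S) → proj₁ fg S ; (outside ∷ S) → proj₂ fg S })
       (λ h → (λ S → h (inside ∷ S)) , (λ S → h (outside ∷ S)))
       (allSubset? (λ S → P? (inside ∷ S)) ×-dec allSubset? (λ S → P? (outside ∷ S)))

covers? : ∀ {n} (X : Subset n) (𝓕 : Family n) → Dec (Covers X 𝓕)
covers? X 𝓕 = allSubset? (λ F → T? (𝓕 F) →-dec nonempty? (X ∩ F))

-- The full set [n] covers any
-- family with no empty member (in particular any intersecting family), so the
-- list minimised over is nonempty in all relevant cases.
τ : ∀ {n} → Family n → ℕ
τ {n} 𝓕 = minimumℕ (map ∣_∣ (filter (λ X → covers? X 𝓕) (allSubsets n)))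

-- Write 𝓕(A, B̄) for the members of 𝓕 containing A and avoiding B.
--
-- If some cover X has |X| ≤ q, enlarge it to B with |B| = q and take any p-set A disjoint
-- from B: every member meets B, so 𝓕(A, B̄) is empty.
--
-- Otherwise fix any q-set B.  Each F ∈ 𝓕(A, B̄) lies in 𝓕(A ∪ {x}, B̄) for exactly the k
-- points x ∈ F, so ∑ₓ |𝓕(A ∪ {x}, B̄)| ≤ k |𝓕(A, B̄)|; averaging over the ≥ n/2 points
-- outside A ∪ B gives an x with |𝓕(A ∪ {x}, B̄)| ≤ (2k/n) |𝓕(A, B̄)|.  After p such steps,
-- |𝓕(A, B̄)| ≤ (2k/n)ᵖ |𝓕|.  Finally |𝓕| ≤ kᵗ nᵏ⁻ᵗ for t = τ(𝓕) by branching: a set S with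
-- |S| < τ misses some member G, every member containing S meets G, so 𝓕(S) is covered by
-- the |G| = k families 𝓕(S ∪ {x}), x ∈ G; once |S| = τ, the k-sets containing S number at
-- most nᵏ⁻ᵗ.
module Submission where

open import Defs
open import Data.Nat using (ℕ; zero; suc; _+_; _*_; _^_; _∸_; _≤_; _<_; _>_; _≤?_; z≤n; s≤s; >-nonZero)
open import Data.Nat.Properties
open import Data.Nat.ListAction using (sum)
open import Data.Bool using (true; false; T?; if_then_else_)
open import Data.List using (List; []; _∷_; map; filter; length; allFin)
open import Data.List.Properties using (map-tabulate; foldr-preservesᵒ)
open import Data.List.Membership.Propositional using (_∈_)
open import Data.List.Membership.Propositional.Properties
  using (∈-allFin; ∈-map⁺; ∈-map⁻; ∈-++⁺ˡ; ∈-++⁺ʳ; ∈-filter⁺; ∈-filter⁻; ∈-cartesianProduct⁺; foldr-selective)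
open import Data.List.Relation.Unary.Any as Any using (here; there; satisfied)
open import Data.List.Relation.Unary.All as All using (All; []; _∷_)
open import Data.List.Relation.Unary.All.Properties using (¬All⇒Any¬; all-filter)
open import Data.List.Relation.Unary.AllPairs using ([]; _∷_)
open import Data.List.Relation.Unary.Unique.Propositional using (Unique)
import Data.List.Relation.Unary.Unique.Propositional.Properties as Unique
open import Data.Fin using (Fin; zero; suc)
open import Data.Fin.Properties using (any?)
open import Data.Fin.Subset
  using (Subset; inside; outside; _∉_; _∩_; _∪_; _⊆_; ∁; ⊤; ⊥; ⁅_⁆; ∣_∣; Nonempty; Empty)
  renaming (_∈_ to _∈ₛ_)
open import Data.Fin.Subset.Properties
  using ( _∈?_; _⊆?_; nonempty?; ⊆-antisym; p⊆q⇒∣p∣≤∣q∣; p⊂q⇒∣p∣<∣q∣; ∣p∣≤n; ∣⊥∣≡0; ∣⊤∣≡n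
        ; ∣∁p∣≡n∸∣p∣; ∉⊥; ∈⊤; ⊆⊤; x∈⁅x⁆; x∈⁅y⁆⇒x≡y; x∈p∪q⁺; x∈p∪q⁻; x∈p∩q⁺; x∈p∩q⁻; p⊆p∪q
        ; x∈∁p⇒x∉p; x∉p⇒x∈∁p; ∪-identityʳ)
open import Data.Vec using (_∷_; [])
open import Data.Product using (_×_; _,_; proj₁; proj₂; ∃; ∃-syntax)
open import Data.Sum using (_⊎_; inj₁; inj₂; [_,_]′)
open import Data.Empty using (⊥-elim)
open import Function using (_∘_; const)
open import Relation.Binary.PropositionalEquality
open import Relation.Nullary using (¬_; Dec; yes; no; does; ¬?; contradiction)
open import Relation.Nullary.Decidable using (_×-dec_; _→-dec_; decidable-stable)
open import Relation.Unary using (Decidable)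
import Algebra.Properties.CommutativeSemigroup

-- Indicators and finite sums

𝟙 : ∀ {a} {P : Set a} → Dec P → ℕ
𝟙 d = if does d then 1 else 0

1≤𝟙 : ∀ {a} {P : Set a} (d : Dec P) → P → 1 ≤ 𝟙 d
1≤𝟙 (yes _) _ = ≤-refl
1≤𝟙 (no ¬p) p = contradiction p ¬p

𝟙≤ : ∀ {a} {P : Set a} (d : Dec P) {m : ℕ} → (P → 1 ≤ m) → 𝟙 d ≤ m
𝟙≤ (yes p) f = f p
𝟙≤ (no _) f = z≤n

*𝟙-monoˡ-≤ : ∀ {a} {P : Set a} (d : Dec P) {m o : ℕ} → (P → m ≤ o) → m * 𝟙 d ≤ o * 𝟙 d
*𝟙-monoˡ-≤ (yes p) m≤o = *-monoˡ-≤ 1 (m≤o p)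
*𝟙-monoˡ-≤ (no _) {m} {o} _ = ≤-reflexive (trans (*-zeroʳ m) (sym (*-zeroʳ o)))

private
  variable
    A B : Set

∑ : List A → (A → ℕ) → ℕ
∑ xs f = sum (map f xs)

syntax ∑ xs (λ x → e) = ∑[ x ← xs ] e

∑-mono : ∀ (xs : List A) {f g : A → ℕ} → (∀ x → f x ≤ g x) → ∑ xs f ≤ ∑ xs g
∑-mono [] _ = z≤n
∑-mono (x ∷ xs) f≤g = +-mono-≤ (f≤g x) (∑-mono xs f≤g)

∑-cong : ∀ (xs : List A) {f g : A → ℕ} → (∀ x → f x ≡ g x) → ∑ xs f ≡ ∑ xs g
∑-cong [] _ = refl
∑-cong (x ∷ xs) f≡g = cong₂ _+_ (f≡g x) (∑-cong xs f≡g)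

∑-zero : ∀ (xs : List A) → ∑[ x ← xs ] 0 ≡ 0
∑-zero [] = refl
∑-zero (_ ∷ xs) = ∑-zero xs

∑-+ : ∀ (xs : List A) (f g : A → ℕ) → ∑[ x ← xs ] (f x + g x) ≡ ∑ xs f + ∑ xs g
∑-+ [] f g = refl
∑-+ (x ∷ xs) f g rewrite ∑-+ xs f g = +-interchange (f x) (g x) (∑ xs f) (∑ xs g)
  where open Algebra.Properties.CommutativeSemigroup +-commutativeSemigroup
          using () renaming (interchange to +-interchange)

∑-*ˡ : ∀ (xs : List A) (c : ℕ) (f : A → ℕ) → ∑[ x ← xs ] (c * f x) ≡ c * ∑ xs f
∑-*ˡ [] c f = sym (*-zeroʳ c)
∑-*ˡ (x ∷ xs) c f rewrite ∑-*ˡ xs c f = sym (*-distribˡ-+ c (f x) (∑ xs f))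

∑-*ʳ : ∀ (xs : List A) (c : ℕ) (f : A → ℕ) → ∑[ x ← xs ] (f x * c) ≡ ∑ xs f * c
∑-*ʳ [] c f = refl
∑-*ʳ (x ∷ xs) c f rewrite ∑-*ʳ xs c f = sym (*-distribʳ-+ c (f x) (∑ xs f))

term≤∑ : ∀ {xs : List A} (f : A → ℕ) {x : A} → x ∈ xs → f x ≤ ∑ xs f
term≤∑ {xs = _ ∷ xs} f (here refl) = m≤m+n _ (∑ xs f)
term≤∑ {xs = y ∷ _} f (there x∈xs) = ≤-trans (term≤∑ f x∈xs) (m≤n+m _ (f y))

∑-comm : ∀ (xs : List A) (ys : List B) (f : A → B → ℕ) →
         ∑[ x ← xs ] ∑[ y ← ys ] f x y ≡ ∑[ y ← ys ] ∑[ x ← xs ] f x y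
∑-comm [] ys f = sym (∑-zero ys)
∑-comm (x ∷ xs) ys f rewrite ∑-comm xs ys f = sym (∑-+ ys (f x) (λ y → ∑[ x ← xs ] f x y))

length-filter : ∀ {P : A → Set} (P? : Decidable P) (xs : List A) →
                length (filter P? xs) ≡ ∑[ x ← xs ] 𝟙 (P? x)
length-filter P? [] = refl
length-filter P? (x ∷ xs) with does (P? x)
... | true = cong suc (length-filter P? xs)
... | false = length-filter P? xs

length≤1 : ∀ {P : A → Set} → (∀ {x y} → P x → P y → x ≡ y) →
           ∀ {xs} → Unique xs → All P xs → length xs ≤ 1
length≤1 P-unique [] [] = z≤n
length≤1 P-unique (_ ∷ []) (_ ∷ []) = ≤-refl
length≤1 P-unique ((x≢y ∷ _) ∷ _) (px ∷ py ∷ _) = contradiction (P-unique px py) x≢y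

∑-allFin-suc : ∀ {n} (f : Fin (suc n) → ℕ) →
               ∑[ x ← allFin (suc n) ] f x ≡ f zero + ∑[ x ← allFin n ] f (suc x)
∑-allFin-suc {n} f = cong (f zero +_) (cong sum
  (trans (map-tabulate suc f) (sym (map-tabulate (λ x → x) (f ∘ suc)))))

n≤2*[n∸m] : ∀ {m n} → 2 * m ≤ n → n ≤ 2 * (n ∸ m)
n≤2*[n∸m] {m} {n} 2m≤n = subst (n ≤_) (sym (*-distribˡ-∸ 2 n m))
  (m+n≤o⇒m≤o∸n n (+-monoʳ-≤ n (≤-trans 2m≤n (≤-reflexive (sym (+-identityʳ n))))))

-- Subsets of [n]

∁-large : ∀ {n} (p : Subset n) → 2 * ∣ p ∣ < n → 0 < ∣ ∁ p ∣ × n ≤ 2 * ∣ ∁ p ∣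
∁-large {n} p 2∣p∣<n rewrite ∣∁p∣≡n∸∣p∣ p =
  m<n⇒0<n∸m (≤-<-trans (m≤n*m ∣ p ∣ 2) 2∣p∣<n) , n≤2*[n∸m] {∣ p ∣} (<⇒≤ 2∣p∣<n)

∣p∣≡∑𝟙 : ∀ {n} (p : Subset n) → ∣ p ∣ ≡ ∑[ x ← allFin n ] 𝟙 (x ∈? p)
∣p∣≡∑𝟙 [] = refl
∣p∣≡∑𝟙 (inside ∷ p) = trans (cong suc (∣p∣≡∑𝟙 p)) (sym (∑-allFin-suc (λ x → 𝟙 (x ∈? (inside ∷ p)))))
∣p∣≡∑𝟙 (outside ∷ p) = trans (∣p∣≡∑𝟙 p) (sym (∑-allFin-suc (λ x → 𝟙 (x ∈? (outside ∷ p)))))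

∣p∪⁅x⁆∣≡1+∣p∣ : ∀ {n} (p : Subset n) {x} → x ∉ p → ∣ p ∪ ⁅ x ⁆ ∣ ≡ suc ∣ p ∣
∣p∪⁅x⁆∣≡1+∣p∣ (inside ∷ p) {zero} x∉p = contradiction Data.Vec.here x∉p
∣p∪⁅x⁆∣≡1+∣p∣ (outside ∷ p) {zero} x∉p = cong suc (cong ∣_∣ (∪-identityʳ p))
∣p∪⁅x⁆∣≡1+∣p∣ (inside ∷ p) {suc x} x∉p = cong suc (∣p∪⁅x⁆∣≡1+∣p∣ p (x∉p ∘ Data.Vec.there))
∣p∪⁅x⁆∣≡1+∣p∣ (outside ∷ p) {suc x} x∉p = ∣p∪⁅x⁆∣≡1+∣p∣ p (x∉p ∘ Data.Vec.there)

∣p∪q∣≤∣p∣+∣q∣ : ∀ {n} (p q : Subset n) → ∣ p ∪ q ∣ ≤ ∣ p ∣ + ∣ q ∣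
∣p∪q∣≤∣p∣+∣q∣ [] [] = z≤n
∣p∪q∣≤∣p∣+∣q∣ (inside ∷ p) (inside ∷ q) = s≤s (≤-trans (∣p∪q∣≤∣p∣+∣q∣ p q) (≤-trans (n≤1+n _) (≤-reflexive (sym (+-suc ∣ p ∣ ∣ q ∣)))))
∣p∪q∣≤∣p∣+∣q∣ (inside ∷ p) (outside ∷ q) = s≤s (∣p∪q∣≤∣p∣+∣q∣ p q)
∣p∪q∣≤∣p∣+∣q∣ (outside ∷ p) (inside ∷ q) = ≤-trans (s≤s (∣p∪q∣≤∣p∣+∣q∣ p q)) (≤-reflexive (sym (+-suc ∣ p ∣ ∣ q ∣)))
∣p∪q∣≤∣p∣+∣q∣ (outside ∷ p) (outside ∷ q) = ∣p∪q∣≤∣p∣+∣q∣ p q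

module _ {n : ℕ} where

  x∈p∪⁅x⁆ : ∀ (p : Subset n) x → x ∈ₛ p ∪ ⁅ x ⁆
  x∈p∪⁅x⁆ p x = x∈p∪q⁺ (inj₂ (x∈⁅x⁆ x))

  p⊆p∪⁅x⁆ : ∀ {p : Subset n} {x} → p ⊆ p ∪ ⁅ x ⁆
  p⊆p∪⁅x⁆ {x = x} = p⊆p∪q ⁅ x ⁆

  p∪⁅x⁆⊆q : ∀ {p q : Subset n} {x} → p ⊆ q → x ∈ₛ q → p ∪ ⁅ x ⁆ ⊆ q
  p∪⁅x⁆⊆q {p} {x = x} p⊆q x∈q y∈ with x∈p∪q⁻ p ⁅ x ⁆ y∈
  ... | inj₁ y∈p = p⊆q y∈p
  ... | inj₂ y∈⁅x⁆ rewrite x∈⁅y⁆⇒x≡y x y∈⁅x⁆ = x∈q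

  ∣p∣<∣q∣⇒∃∈q∉p : ∀ (p q : Subset n) → ∣ p ∣ < ∣ q ∣ → ∃ λ x → x ∈ₛ q × x ∉ p
  ∣p∣<∣q∣⇒∃∈q∉p p q ∣p∣<∣q∣ with any? (λ x → x ∈? q ×-dec ¬? (x ∈? p))
  ... | yes found = found
  ... | no none = contradiction (p⊆q⇒∣p∣≤∣q∣ q⊆p) (<⇒≱ ∣p∣<∣q∣)
    where
    q⊆p : q ⊆ p
    q⊆p {x} x∈q = decidable-stable (x ∈? p) (λ x∉p → none (x , x∈q , x∉p))

  ⊆∧∣∣≤⇒≡ : ∀ {p q : Subset n} → p ⊆ q → ∣ q ∣ ≤ ∣ p ∣ → p ≡ q
  ⊆∧∣∣≤⇒≡ {p} {q} p⊆q ∣q∣≤∣p∣ = ⊆-antisym p⊆q q⊆p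
    where
    q⊆p : q ⊆ p
    q⊆p {x} x∈q = decidable-stable (x ∈? p)
      (λ x∉p → <⇒≱ (p⊂q⇒∣p∣<∣q∣ (p⊆q , x , x∈q , x∉p)) ∣q∣≤∣p∣)

  ∣p∪⁅x⁆∣+m≡ : ∀ {p : Subset n} {x m t} → x ∉ p → ∣ p ∣ + suc m ≡ t → ∣ p ∪ ⁅ x ⁆ ∣ + m ≡ t
  ∣p∪⁅x⁆∣+m≡ {p} {m = m} x∉p ∣p∣+1+m≡t =
    trans (cong (_+ m) (∣p∪⁅x⁆∣≡1+∣p∣ p x∉p)) (trans (sym (+-suc ∣ p ∣ m)) ∣p∣+1+m≡t)

  ∃-⊆-of-size : ∀ {p r : Subset n} {m} → p ⊆ r → ∣ p ∣ ≤ m → m ≤ ∣ r ∣ →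
                ∃ λ q → p ⊆ q × q ⊆ r × ∣ q ∣ ≡ m
  ∃-⊆-of-size {p} {r} {m} p⊆r ∣p∣≤m m≤∣r∣
    with grow (m ∸ ∣ p ∣) p⊆r (subst (_≤ ∣ r ∣) (sym (m+[n∸m]≡n ∣p∣≤m)) m≤∣r∣)
    where
    grow : ∀ d {p} → p ⊆ r → ∣ p ∣ + d ≤ ∣ r ∣ → ∃ λ q → p ⊆ q × q ⊆ r × ∣ q ∣ ≡ ∣ p ∣ + d
    grow zero {p} p⊆r _ = p , (λ x∈p → x∈p) , p⊆r , sym (+-identityʳ ∣ p ∣)
    grow (suc d) {p} p⊆r size≤
      with ∣p∣<∣q∣⇒∃∈q∉p p r (≤-trans (s≤s (m≤m+n ∣ p ∣ d)) (≤-trans (≤-reflexive (sym (+-suc ∣ p ∣ d))) size≤))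
    ... | x , x∈r , x∉p
      with grow d (p∪⁅x⁆⊆q p⊆r x∈r) (≤-trans (≤-reflexive (∣p∪⁅x⁆∣+m≡ x∉p refl)) size≤)
    ... | q , p∪x⊆q , q⊆r , ∣q∣≡ = q , p∪x⊆q ∘ p⊆p∪⁅x⁆ , q⊆r , trans ∣q∣≡ (∣p∪⁅x⁆∣+m≡ x∉p refl)
  ... | q , p⊆q , q⊆r , ∣q∣≡ = q , p⊆q , q⊆r , trans ∣q∣≡ (m+[n∸m]≡n ∣p∣≤m)

  ∃-⊆-of-size′ : ∀ {m} (r : Subset n) → m ≤ ∣ r ∣ → ∃ λ q → q ⊆ r × ∣ q ∣ ≡ m
  ∃-⊆-of-size′ {m} r m≤∣r∣ with ∃-⊆-of-size (λ x∈⊥ → contradiction x∈⊥ ∉⊥) (subst (_≤ m) (sym (∣⊥∣≡0 n)) z≤n) m≤∣r∣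
  ... | q , _ , q⊆r , ∣q∣≡m = q , q⊆r , ∣q∣≡m

  ∑-gated-≤ : ∀ (G : Subset n) {f : Fin n → ℕ} {K} → (∀ x → x ∈ₛ G → f x ≤ K) →
              ∑[ x ← allFin n ] (𝟙 (x ∈? G) * f x) ≤ ∣ G ∣ * K
  ∑-gated-≤ G {f} {K} f≤K = begin
    ∑[ x ← allFin n ] (𝟙 (x ∈? G) * f x)   ≤⟨ ∑-mono (allFin n) gated ⟩
    ∑[ x ← allFin n ] (𝟙 (x ∈? G) * K)     ≡⟨ ∑-*ʳ (allFin n) K (λ x → 𝟙 (x ∈? G)) ⟩
    (∑[ x ← allFin n ] 𝟙 (x ∈? G)) * K     ≡⟨ cong (_* K) (∣p∣≡∑𝟙 G) ⟨
    ∣ G ∣ * K                              ∎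
    where
    open ≤-Reasoning
    gated : ∀ x → 𝟙 (x ∈? G) * f x ≤ 𝟙 (x ∈? G) * K
    gated x with x ∈? G
    ... | yes x∈G = *-monoʳ-≤ 1 (f≤K x x∈G)
    ... | no _ = z≤n

  ∃-average : ∀ (Y : Subset n) (f : Fin n → ℕ) → 0 < ∣ Y ∣ →
              ∃ λ x → x ∈ₛ Y × ∣ Y ∣ * f x ≤ ∑[ y ← allFin n ] f y
  ∃-average Y f 0<∣Y∣ with any? (λ x → x ∈? Y ×-dec (∣ Y ∣ * f x ≤? ∑[ y ← allFin n ] f y))
  ... | yes found = found
  ... | no none = contradiction (*-cancelˡ-≤ ∣ Y ∣ {{>-nonZero 0<∣Y∣}} ∣Y∣*[1+S]≤∣Y∣*S) (<-irrefl refl)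
    where
    S = ∑[ y ← allFin n ] f y
    ∣Y∣*[1+S]≤∣Y∣*S : ∣ Y ∣ * suc S ≤ ∣ Y ∣ * S
    ∣Y∣*[1+S]≤∣Y∣*S = begin
      ∣ Y ∣ * suc S                                      ≡⟨ cong (_* suc S) (∣p∣≡∑𝟙 Y) ⟩
      (∑[ x ← allFin n ] 𝟙 (x ∈? Y)) * suc S             ≡⟨ ∑-*ʳ (allFin n) (suc S) (λ x → 𝟙 (x ∈? Y)) ⟨
      ∑[ x ← allFin n ] (𝟙 (x ∈? Y) * suc S)             ≤⟨ ∑-mono (allFin n) gated ⟩
      ∑[ x ← allFin n ] (∣ Y ∣ * f x)                    ≡⟨ ∑-*ˡ (allFin n) ∣ Y ∣ f ⟩
      ∣ Y ∣ * S                                          ∎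
      where
      open ≤-Reasoning
      gated : ∀ x → 𝟙 (x ∈? Y) * suc S ≤ ∣ Y ∣ * f x
      gated x with x ∈? Y
      ... | yes x∈Y = ≤-trans (≤-reflexive (+-identityʳ (suc S))) (≰⇒> (λ le → none (x , x∈Y , le)))
      ... | no _ = z≤n

∈-allSubsets : ∀ {n} (S : Subset n) → S ∈ allSubsets n
∈-allSubsets [] = here refl
∈-allSubsets (inside ∷ S) = ∈-++⁺ˡ (∈-map⁺ (inside ∷_) (∈-allSubsets S))
∈-allSubsets (outside ∷ S) = ∈-++⁺ʳ _ (∈-map⁺ (outside ∷_) (∈-allSubsets S))

allSubsets-unique : ∀ n → Unique (allSubsets n)
allSubsets-unique zero = [] ∷ []
allSubsets-unique (suc n) = Unique.++⁺
  (Unique.map⁺ ∷-injectiveʳ (allSubsets-unique n))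
  (Unique.map⁺ ∷-injectiveʳ (allSubsets-unique n))
  disjoint
  where
  open import Data.Vec.Properties using (∷-injectiveʳ)
  disjoint : ∀ {S} → ¬ (S ∈ map (inside ∷_) (allSubsets n) × S ∈ map (outside ∷_) (allSubsets n))
  disjoint (S∈ᵢ , S∈ₒ) with ∈-map⁻ (inside ∷_) S∈ᵢ | ∈-map⁻ (outside ∷_) S∈ₒ
  ... | _ , _ , refl | _ , _ , ()

¬∀⇒∃¬-Subset : ∀ {n p} {P : Subset n → Set p} → Decidable P → ¬ (∀ S → P S) → ∃ λ S → ¬ P S
¬∀⇒∃¬-Subset {n} P? ¬∀P =
  satisfied (¬All⇒Any¬ P? (allSubsets n) (λ all → ¬∀P (λ S → All.lookup all (∈-allSubsets S))))

-- Minima, covers and the covering number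

minimumℕ≤ : ∀ {m xs} → m ∈ xs → minimumℕ xs ≤ m
minimumℕ≤ {m} {x ∷ xs} m∈ = foldr-preservesᵒ (λ a b → [ m≤n⇒m⊓o≤n b , m≤n⇒o⊓m≤n a ]′) x xs (lift m∈)
  where
  lift : m ∈ x ∷ xs → x ≤ m ⊎ Any.Any (_≤ m) xs
  lift (here refl) = inj₁ ≤-refl
  lift (there m∈xs) = inj₂ (Any.map (≤-reflexive ∘ sym) m∈xs)

minimumℕ∈ : ∀ {m xs} → m ∈ xs → minimumℕ xs ∈ xs
minimumℕ∈ {xs = x ∷ xs} _ with foldr-selective ⊓-sel x xs
... | inj₁ ≡x = here ≡x
... | inj₂ ∈xs = there ∈xs

module _ {n : ℕ} (𝓕 : Family n) where

  τ≤∣X∣ : ∀ {X} → Covers X 𝓕 → τ 𝓕 ≤ ∣ X ∣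
  τ≤∣X∣ {X} X-covers =
    minimumℕ≤ (∈-map⁺ ∣_∣ (∈-filter⁺ (λ X → covers? X 𝓕) (∈-allSubsets X) X-covers))

  τ-attained : Intersecting 𝓕 → ∃ λ X → Covers X 𝓕 × ∣ X ∣ ≡ τ 𝓕
  τ-attained intersecting
    with ∈-map⁻ ∣_∣ (minimumℕ∈ (∈-map⁺ ∣_∣ (∈-filter⁺ (λ X → covers? X 𝓕) (∈-allSubsets ⊤) ⊤-covers)))
    where
    ⊤-covers : Covers ⊤ 𝓕
    ⊤-covers F F∈𝓕 with intersecting F F F∈𝓕 F∈𝓕
    ... | x , x∈F∩F = x , x∈p∩q⁺ (∈⊤ , proj₁ (x∈p∩q⁻ F F x∈F∩F))
  ... | X , X∈ , τ≡∣X∣ = X , proj₂ (∈-filter⁻ (λ X → covers? X 𝓕) {xs = allSubsets n} X∈) , sym τ≡∣X∣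

  uncovered-member : ∀ {S} → ¬ Covers S 𝓕 → ∃ λ G → G ∈F 𝓕 × Empty (S ∩ G)
  uncovered-member {S} S-not-cover with ¬∀⇒∃¬-Subset (λ G → T? (𝓕 G) →-dec nonempty? (S ∩ G)) S-not-cover
  ... | G , ¬[G∈𝓕→S∩G≠∅] =
    G , decidable-stable (T? (𝓕 G)) (λ G∉𝓕 → ¬[G∈𝓕→S∩G≠∅] (⊥-elim ∘ G∉𝓕)) , ¬[G∈𝓕→S∩G≠∅] ∘ const

  member-covers : Intersecting 𝓕 → ∀ {G} → G ∈F 𝓕 → Covers G 𝓕
  member-covers intersecting {G} G∈𝓕 F F∈𝓕 = intersecting G F G∈𝓕 F∈𝓕

  τ≤k : ∀ {k} → IsUniform k 𝓕 → Intersecting 𝓕 → τ 𝓕 ≤ k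
  τ≤k uniform intersecting with covers? ⊥ 𝓕
  ... | yes ⊥-covers = ≤-trans (τ≤∣X∣ ⊥-covers) (≤-trans (≤-reflexive (∣⊥∣≡0 n)) z≤n)
  ... | no ⊥-not-cover with uncovered-member ⊥-not-cover
  ...   | G , G∈𝓕 , _ = ≤-trans (τ≤∣X∣ (member-covers intersecting G∈𝓕)) (≤-reflexive (uniform G G∈𝓕))

-- The families 𝓕(A, B̄)

module _ {n : ℕ} (𝓕 : Family n) where

  InLink : Subset n → Subset n → Subset n → Set
  InLink A B F = F ∈F 𝓕 × A ⊆ F × ¬ Nonempty (B ∩ F)

  inLink? : ∀ A B → Decidable (InLink A B)
  inLink? A B F = T? (𝓕 F) ×-dec (A ⊆? F) ×-dec ¬? (nonempty? (B ∩ F))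

  countAB≡∑ : ∀ A B → countAB 𝓕 A B ≡ ∑[ F ← allSubsets n ] 𝟙 (inLink? A B F)
  countAB≡∑ A B = length-filter (inLink? A B) (allSubsets n)

  countAB≡0 : ∀ A {B} → Covers B 𝓕 → countAB 𝓕 A B ≡ 0
  countAB≡0 A {B} B-covers = n≤0⇒n≡0 (begin
    countAB 𝓕 A B                             ≡⟨ countAB≡∑ A B ⟩
    ∑[ F ← allSubsets n ] 𝟙 (inLink? A B F)   ≤⟨ ∑-mono (allSubsets n) (λ F → 𝟙≤ (inLink? A B F) missed) ⟩
    ∑[ F ← allSubsets n ] 0                   ≡⟨ ∑-zero (allSubsets n) ⟩
    0                                         ∎)
    where
    open ≤-Reasoning
    missed : ∀ {F} → InLink A B F → 1 ≤ 0
    missed {F} (F∈𝓕 , _ , B∩F=∅) = contradiction (B-covers F F∈𝓕) B∩F=∅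

  countAB≤∑-branch : ∀ {S B} (G : Subset n) → (∀ {F} → InLink S B F → Nonempty (G ∩ F)) →
                     countAB 𝓕 S B ≤ ∑[ x ← allFin n ] (𝟙 (x ∈? G) * countAB 𝓕 (S ∪ ⁅ x ⁆) B)
  countAB≤∑-branch {S} {B} G meets = begin
    countAB 𝓕 S B
      ≡⟨ countAB≡∑ S B ⟩
    ∑[ F ← allSubsets n ] 𝟙 (inLink? S B F)
      ≤⟨ ∑-mono (allSubsets n) branch ⟩
    ∑[ F ← allSubsets n ] ∑[ x ← allFin n ] (𝟙 (x ∈? G) * 𝟙 (inLink? (S ∪ ⁅ x ⁆) B F))
      ≡⟨ ∑-comm (allSubsets n) (allFin n) _ ⟩
    ∑[ x ← allFin n ] ∑[ F ← allSubsets n ] (𝟙 (x ∈? G) * 𝟙 (inLink? (S ∪ ⁅ x ⁆) B F))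
      ≡⟨ ∑-cong (allFin n) (λ x → trans (∑-*ˡ (allSubsets n) (𝟙 (x ∈? G)) (𝟙 ∘ inLink? (S ∪ ⁅ x ⁆) B))
                                          (cong (𝟙 (x ∈? G) *_) (sym (countAB≡∑ _ B)))) ⟩
    ∑[ x ← allFin n ] (𝟙 (x ∈? G) * countAB 𝓕 (S ∪ ⁅ x ⁆) B)
      ∎
    where
    open ≤-Reasoning
    branch : ∀ F → 𝟙 (inLink? S B F) ≤ ∑[ x ← allFin n ] (𝟙 (x ∈? G) * 𝟙 (inLink? (S ∪ ⁅ x ⁆) B F))
    branch F = 𝟙≤ (inLink? S B F) λ { (F∈𝓕 , S⊆F , B∩F=∅) →
      let (x , x∈G∩F) = meets (F∈𝓕 , S⊆F , B∩F=∅)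
          (x∈G , x∈F) = x∈p∩q⁻ G F x∈G∩F
      in ≤-trans (*-mono-≤ (1≤𝟙 (x ∈? G) x∈G) (1≤𝟙 (inLink? _ B F) (F∈𝓕 , p∪⁅x⁆⊆q S⊆F x∈F , B∩F=∅)))
                 (term≤∑ (λ y → 𝟙 (y ∈? G) * 𝟙 (inLink? (S ∪ ⁅ y ⁆) B F)) (∈-allFin x)) }

  module _ {k : ℕ} (uniform : IsUniform k 𝓕) where

    countAB≤1 : ∀ {S} B → ∣ S ∣ ≡ k → countAB 𝓕 S B ≤ 1
    countAB≤1 {S} B ∣S∣≡k =
      length≤1 same (Unique.filter⁺ (inLink? S B) (allSubsets-unique n)) (all-filter (inLink? S B) (allSubsets n))
      where
      S≡ : ∀ {F} → InLink S B F → S ≡ F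
      S≡ {F} (F∈𝓕 , S⊆F , _) = ⊆∧∣∣≤⇒≡ S⊆F (≤-reflexive (trans (uniform F F∈𝓕) (sym ∣S∣≡k)))
      same : ∀ {F F′} → InLink S B F → InLink S B F′ → F ≡ F′
      same F∈ F′∈ = trans (sym (S≡ F∈)) (S≡ F′∈)

    countAB≤n^ : ∀ m {S} B → ∣ S ∣ + m ≡ k → countAB 𝓕 S B ≤ n ^ m
    countAB≤n^ zero B ∣S∣+0≡k = countAB≤1 B (trans (sym (+-identityʳ _)) ∣S∣+0≡k)
    countAB≤n^ (suc m) {S} B ∣S∣+1+m≡k = begin
      countAB 𝓕 S B                                                  ≤⟨ countAB≤∑-branch (∁ S) meets-∁S ⟩
      ∑[ x ← allFin n ] (𝟙 (x ∈? ∁ S) * countAB 𝓕 (S ∪ ⁅ x ⁆) B)    ≤⟨ ∑-gated-≤ (∁ S) extend ⟩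
      ∣ ∁ S ∣ * n ^ m                                                ≤⟨ *-monoˡ-≤ (n ^ m) (∣p∣≤n (∁ S)) ⟩
      n ^ suc m                                                      ∎
      where
      open ≤-Reasoning
      meets-∁S : ∀ {F} → InLink S B F → Nonempty (∁ S ∩ F)
      meets-∁S {F} (F∈𝓕 , _ , _) =
        let ∣S∣<∣F∣ = ≤-trans (s≤s (m≤m+n ∣ S ∣ m))
                        (≤-reflexive (trans (sym (+-suc ∣ S ∣ m)) (trans ∣S∣+1+m≡k (sym (uniform F F∈𝓕)))))
            (x , x∈F , x∉S) = ∣p∣<∣q∣⇒∃∈q∉p S F ∣S∣<∣F∣
        in x , x∈p∩q⁺ (x∉p⇒x∈∁p x∉S , x∈F)
      extend : ∀ x → x ∈ₛ ∁ S → countAB 𝓕 (S ∪ ⁅ x ⁆) B ≤ n ^ m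
      extend x x∈∁S = countAB≤n^ m B (∣p∪⁅x⁆∣+m≡ (x∈∁p⇒x∉p x∈∁S) ∣S∣+1+m≡k)

    countAB≤k^n^ : Intersecting 𝓕 → ∀ {t} → t ≤ τ 𝓕 → t ≤ k →
                   ∀ m {S} B → ∣ S ∣ + m ≡ t → countAB 𝓕 S B ≤ k ^ m * n ^ (k ∸ t)
    countAB≤k^n^ intersecting {t} t≤τ t≤k zero {S} B ∣S∣+0≡t =
      ≤-trans (countAB≤n^ (k ∸ t) B ∣S∣+[k∸t]≡k) (≤-reflexive (sym (+-identityʳ _)))
      where
      ∣S∣+[k∸t]≡k : ∣ S ∣ + (k ∸ t) ≡ k
      ∣S∣+[k∸t]≡k = trans (cong (_+ (k ∸ t)) (trans (sym (+-identityʳ _)) ∣S∣+0≡t)) (m+[n∸m]≡n t≤k)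
    countAB≤k^n^ intersecting {t} t≤τ t≤k (suc m) {S} B ∣S∣+1+m≡t
      with uncovered-member 𝓕 S-not-cover
      where
      S-not-cover : ¬ Covers S 𝓕
      S-not-cover S-covers = <⇒≱ (≤-trans (s≤s (m≤m+n ∣ S ∣ m)) (≤-reflexive (trans (sym (+-suc ∣ S ∣ m)) ∣S∣+1+m≡t)))
                                  (≤-trans t≤τ (τ≤∣X∣ 𝓕 S-covers))
    ... | G , G∈𝓕 , S∩G=∅ = begin
      countAB 𝓕 S B                                               ≤⟨ countAB≤∑-branch G (λ (F∈𝓕 , _) → intersecting G _ G∈𝓕 F∈𝓕) ⟩
      ∑[ x ← allFin n ] (𝟙 (x ∈? G) * countAB 𝓕 (S ∪ ⁅ x ⁆) B)   ≤⟨ ∑-gated-≤ G extend ⟩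
      ∣ G ∣ * (k ^ m * n ^ (k ∸ t))                               ≡⟨ cong (_* _) (uniform G G∈𝓕) ⟩
      k * (k ^ m * n ^ (k ∸ t))                                   ≡⟨ *-assoc k (k ^ m) _ ⟨
      k ^ suc m * n ^ (k ∸ t)                                     ∎
      where
      open ≤-Reasoning
      extend : ∀ x → x ∈ₛ G → countAB 𝓕 (S ∪ ⁅ x ⁆) B ≤ k ^ m * n ^ (k ∸ t)
      extend x x∈G = countAB≤k^n^ intersecting t≤τ t≤k m B
        (∣p∪⁅x⁆∣+m≡ (λ x∈S → S∩G=∅ (x , x∈p∩q⁺ (x∈S , x∈G))) ∣S∣+1+m≡t)

    ∑-countAB-extend-≤ : ∀ A B → ∑[ x ← allFin n ] countAB 𝓕 (A ∪ ⁅ x ⁆) B ≤ k * countAB 𝓕 A B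
    ∑-countAB-extend-≤ A B = begin
      ∑[ x ← allFin n ] countAB 𝓕 (A ∪ ⁅ x ⁆) B
        ≡⟨ ∑-cong (allFin n) (λ x → countAB≡∑ (A ∪ ⁅ x ⁆) B) ⟩
      ∑[ x ← allFin n ] ∑[ F ← allSubsets n ] 𝟙 (inLink? (A ∪ ⁅ x ⁆) B F)
        ≡⟨ ∑-comm (allFin n) (allSubsets n) _ ⟩
      ∑[ F ← allSubsets n ] ∑[ x ← allFin n ] 𝟙 (inLink? (A ∪ ⁅ x ⁆) B F)
        ≤⟨ ∑-mono (allSubsets n) (λ F → ∑-mono (allFin n) (λ x → x∈F∈link F x)) ⟩
      ∑[ F ← allSubsets n ] ∑[ x ← allFin n ] (𝟙 (x ∈? F) * 𝟙 (inLink? A B F))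
        ≡⟨ ∑-cong (allSubsets n) (λ F → trans (∑-*ʳ (allFin n) (𝟙 (inLink? A B F)) (λ x → 𝟙 (x ∈? F)))
                                               (cong (_* 𝟙 (inLink? A B F)) (sym (∣p∣≡∑𝟙 F)))) ⟩
      ∑[ F ← allSubsets n ] (∣ F ∣ * 𝟙 (inLink? A B F))
        ≤⟨ ∑-mono (allSubsets n) (λ F → *𝟙-monoˡ-≤ (inLink? A B F) (λ (F∈𝓕 , _) → ≤-reflexive (uniform F F∈𝓕))) ⟩
      ∑[ F ← allSubsets n ] (k * 𝟙 (inLink? A B F))
        ≡⟨ ∑-*ˡ (allSubsets n) k (𝟙 ∘ inLink? A B) ⟩
      k * ∑[ F ← allSubsets n ] 𝟙 (inLink? A B F)
        ≡⟨ cong (k *_) (countAB≡∑ A B) ⟨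
      k * countAB 𝓕 A B
        ∎
      where
      open ≤-Reasoning
      x∈F∈link : ∀ F x → 𝟙 (inLink? (A ∪ ⁅ x ⁆) B F) ≤ 𝟙 (x ∈? F) * 𝟙 (inLink? A B F)
      x∈F∈link F x = 𝟙≤ (inLink? (A ∪ ⁅ x ⁆) B F) λ (F∈𝓕 , A∪x⊆F , B∩F=∅) →
        *-mono-≤ (1≤𝟙 (x ∈? F) (A∪x⊆F (x∈p∪⁅x⁆ A x))) (1≤𝟙 (inLink? A B F) (F∈𝓕 , A∪x⊆F ∘ p⊆p∪⁅x⁆ , B∩F=∅))

    extension-step : ∀ A B → 2 * (∣ A ∣ + ∣ B ∣) < n →
      ∃ λ x → x ∉ A × x ∉ B × countAB 𝓕 (A ∪ ⁅ x ⁆) B * n ≤ 2 * k * countAB 𝓕 A B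
    extension-step A B 2[∣A∣+∣B∣]<n
      with ∁-large (A ∪ B) (≤-<-trans (*-monoʳ-≤ 2 (∣p∪q∣≤∣p∣+∣q∣ A B)) 2[∣A∣+∣B∣]<n)
    ... | 0<∣Y∣ , n≤2∣Y∣ with ∃-average (∁ (A ∪ B)) (λ y → countAB 𝓕 (A ∪ ⁅ y ⁆) B) 0<∣Y∣
    ... | x , x∈Y , ∣Y∣*c≤∑ = x , x∉A∪B ∘ x∈p∪q⁺ ∘ inj₁ , x∉A∪B ∘ x∈p∪q⁺ ∘ inj₂ , (begin
      c * n                  ≤⟨ *-monoʳ-≤ c n≤2∣Y∣ ⟩
      c * (2 * ∣ Y ∣)        ≡⟨ *-comm c (2 * ∣ Y ∣) ⟩
      2 * ∣ Y ∣ * c          ≡⟨ *-assoc 2 ∣ Y ∣ c ⟩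
      2 * (∣ Y ∣ * c)        ≤⟨ *-monoʳ-≤ 2 (≤-trans ∣Y∣*c≤∑ (∑-countAB-extend-≤ A B)) ⟩
      2 * (k * W)            ≡⟨ *-assoc 2 k W ⟨
      2 * k * W              ∎)
      where
      open ≤-Reasoning
      Y : Subset n
      Y = ∁ (A ∪ B)
      c W : ℕ
      c = countAB 𝓕 (A ∪ ⁅ x ⁆) B
      W = countAB 𝓕 A B
      x∉A∪B : x ∉ A ∪ B
      x∉A∪B = x∈∁p⇒x∉p x∈Y

    greedy : ∀ i {B} → 2 * (i + ∣ B ∣) ≤ n →
      ∃ λ A → ∣ A ∣ ≡ i × Empty (A ∩ B) × countAB 𝓕 A B * n ^ i ≤ (2 * k) ^ i * countAB 𝓕 ⊥ B
    greedy zero {B} _ =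
      ⊥ , ∣⊥∣≡0 n , (λ (x , x∈⊥∩B) → ∉⊥ (proj₁ (x∈p∩q⁻ ⊥ B x∈⊥∩B))) ,
      ≤-reflexive (trans (*-identityʳ _) (sym (+-identityʳ _)))
    greedy (suc i) {B} 2[1+i+∣B∣]≤n with greedy i (≤-trans (*-monoʳ-≤ 2 (n≤1+n _)) 2[1+i+∣B∣]≤n)
    ... | A , ∣A∣≡i , A∩B=∅ , bound with extension-step A B 2[∣A∣+∣B∣]<n
      where
      2[∣A∣+∣B∣]<n : 2 * (∣ A ∣ + ∣ B ∣) < n
      2[∣A∣+∣B∣]<n rewrite ∣A∣≡i = <-≤-trans (*-monoʳ-< 2 (n<1+n (i + ∣ B ∣))) 2[1+i+∣B∣]≤n
    ...   | x , x∉A , x∉B , step = A ∪ ⁅ x ⁆ , trans (∣p∪⁅x⁆∣≡1+∣p∣ A x∉A) (cong suc ∣A∣≡i) , A∪x∩B=∅ , (begin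
      countAB 𝓕 (A ∪ ⁅ x ⁆) B * (n * n ^ i)      ≡⟨ *-assoc (countAB 𝓕 (A ∪ ⁅ x ⁆) B) n (n ^ i) ⟨
      countAB 𝓕 (A ∪ ⁅ x ⁆) B * n * n ^ i        ≤⟨ *-monoˡ-≤ (n ^ i) step ⟩
      2 * k * countAB 𝓕 A B * n ^ i              ≡⟨ *-assoc (2 * k) (countAB 𝓕 A B) (n ^ i) ⟩
      2 * k * (countAB 𝓕 A B * n ^ i)            ≤⟨ *-monoʳ-≤ (2 * k) bound ⟩
      2 * k * ((2 * k) ^ i * countAB 𝓕 ⊥ B)      ≡⟨ *-assoc (2 * k) ((2 * k) ^ i) (countAB 𝓕 ⊥ B) ⟨
      (2 * k) ^ suc i * countAB 𝓕 ⊥ B            ∎)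
      where
      open ≤-Reasoning
      A∪x∩B=∅ : Empty ((A ∪ ⁅ x ⁆) ∩ B)
      A∪x∩B=∅ (y , y∈A∪x∩B) with x∈p∩q⁻ (A ∪ ⁅ x ⁆) B y∈A∪x∩B
      ... | y∈A∪x , y∈B with x∈p∪q⁻ A ⁅ x ⁆ y∈A∪x
      ...   | inj₁ y∈A = A∩B=∅ (y , x∈p∩q⁺ (y∈A , y∈B))
      ...   | inj₂ y∈⁅x⁆ = x∉B (subst (_∈ₛ B) (x∈⁅y⁆⇒x≡y x y∈⁅x⁆) y∈B)

β≤countAB : ∀ {n} (𝓕 : Family n) {p q} {A B : Subset n} →
            ∣ A ∣ ≡ p → ∣ B ∣ ≡ q → Empty (A ∩ B) → β p q 𝓕 ≤ countAB 𝓕 A B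
β≤countAB {n} 𝓕 {A = A} {B} ∣A∣≡p ∣B∣≡q A∩B=∅ =
  minimumℕ≤ (∈-map⁺ _ (∈-filter⁺ _ (∈-cartesianProduct⁺ (∈-allSubsets A) (∈-allSubsets B)) (∣A∣≡p , ∣B∣≡q , A∩B=∅)))

∃-disjoint-pair-⊇ : ∀ {n p q} {X : Subset n} → ∣ X ∣ ≤ q → p + q ≤ n →
  ∃ λ A → ∃ λ B → X ⊆ B × ∣ A ∣ ≡ p × ∣ B ∣ ≡ q × Empty (A ∩ B)
∃-disjoint-pair-⊇ {n} {p} {q} {X} ∣X∣≤q p+q≤n
  with ∃-⊆-of-size ⊆⊤ ∣X∣≤q (subst (q ≤_) (sym (∣⊤∣≡n n)) (≤-trans (m≤n+m q p) p+q≤n))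
... | B , X⊆B , _ , ∣B∣≡q with ∃-⊆-of-size′ {m = p} (∁ B) p≤∣∁B∣
  where
  p≤∣∁B∣ : p ≤ ∣ ∁ B ∣
  p≤∣∁B∣ = subst (p ≤_) (sym (trans (∣∁p∣≡n∸∣p∣ B) (cong (n ∸_) ∣B∣≡q))) (m+n≤o⇒m≤o∸n p p+q≤n)
... | A , A⊆∁B , ∣A∣≡p =
  A , B , X⊆B , ∣A∣≡p , ∣B∣≡q ,
  λ (x , x∈A∩B) → let (x∈A , x∈B) = x∈p∩q⁻ A B x∈A∩B in x∈∁p⇒x∉p (A⊆∁B x∈A) x∈B

β≡0 : ∀ {n p q} (𝓕 : Family n) → Intersecting 𝓕 → τ 𝓕 ≤ q → p + q ≤ n → β p q 𝓕 ≡ 0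
β≡0 𝓕 intersecting τ≤q p+q≤n with τ-attained 𝓕 intersecting
... | X , X-covers , ∣X∣≡τ with ∃-disjoint-pair-⊇ (≤-trans (≤-reflexive ∣X∣≡τ) τ≤q) p+q≤n
...   | A , B , X⊆B , ∣A∣≡p , ∣B∣≡q , A∩B=∅ = n≤0⇒n≡0 (≤-trans (β≤countAB 𝓕 ∣A∣≡p ∣B∣≡q A∩B=∅)
  (≤-reflexive (countAB≡0 𝓕 A (λ F F∈𝓕 → let (x , x∈X∩F) = X-covers F F∈𝓕 ; (x∈X , x∈F) = x∈p∩q⁻ X F x∈X∩F
                                          in x , x∈p∩q⁺ (X⊆B x∈X , x∈F)))))

β*n^[p+τ]≤ : ∀ {n k} (𝓕 : Family n) p {q} → IsUniform k 𝓕 → Intersecting 𝓕 → 2 * (p + q) ≤ n →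
             β p q 𝓕 * n ^ (p + τ 𝓕) ≤ (2 * k) ^ p * k ^ τ 𝓕 * n ^ k
β*n^[p+τ]≤ {n} {k} 𝓕 p {q} uniform intersecting 2[p+q]≤n
  with ∃-⊆-of-size′ {m = q} ⊤ (subst (q ≤_) (sym (∣⊤∣≡n n)) (≤-trans (m≤n+m q p) (≤-trans (m≤n*m (p + q) 2) 2[p+q]≤n)))
... | B , _ , ∣B∣≡q with greedy 𝓕 uniform p {B} (subst (λ b → 2 * (p + b) ≤ n) (sym ∣B∣≡q) 2[p+q]≤n)
...   | A , ∣A∣≡p , A∩B=∅ , greedy-bound = begin
  β p q 𝓕 * n ^ (p + t)                             ≡⟨ cong (β p q 𝓕 *_) (^-distribˡ-+-* n p t) ⟩
  β p q 𝓕 * (n ^ p * n ^ t)                         ≡⟨ *-assoc (β p q 𝓕) (n ^ p) (n ^ t) ⟨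
  β p q 𝓕 * n ^ p * n ^ t                           ≤⟨ *-monoˡ-≤ (n ^ t) (*-monoˡ-≤ (n ^ p) (β≤countAB 𝓕 ∣A∣≡p ∣B∣≡q A∩B=∅)) ⟩
  countAB 𝓕 A B * n ^ p * n ^ t                     ≤⟨ *-monoˡ-≤ (n ^ t) greedy-bound ⟩
  (2 * k) ^ p * countAB 𝓕 ⊥ B * n ^ t               ≤⟨ *-monoˡ-≤ (n ^ t) (*-monoʳ-≤ ((2 * k) ^ p) ∣𝓕⟨⊥,B⟩∣≤) ⟩
  (2 * k) ^ p * (k ^ t * n ^ (k ∸ t)) * n ^ t       ≡⟨ cong (_* n ^ t) (*-assoc ((2 * k) ^ p) (k ^ t) (n ^ (k ∸ t))) ⟨
  (2 * k) ^ p * k ^ t * n ^ (k ∸ t) * n ^ t         ≡⟨ *-assoc ((2 * k) ^ p * k ^ t) (n ^ (k ∸ t)) (n ^ t) ⟩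
  (2 * k) ^ p * k ^ t * (n ^ (k ∸ t) * n ^ t)       ≡⟨ cong ((2 * k) ^ p * k ^ t *_) n^[k∸t]*n^t≡n^k ⟩
  (2 * k) ^ p * k ^ t * n ^ k                       ∎
  where
  open ≤-Reasoning
  t : ℕ
  t = τ 𝓕
  t≤k : t ≤ k
  t≤k = τ≤k 𝓕 uniform intersecting
  ∣𝓕⟨⊥,B⟩∣≤ : countAB 𝓕 ⊥ B ≤ k ^ t * n ^ (k ∸ t)
  ∣𝓕⟨⊥,B⟩∣≤ = countAB≤k^n^ 𝓕 uniform intersecting ≤-refl t≤k t B (cong (_+ t) (∣⊥∣≡0 n))
  n^[k∸t]*n^t≡n^k : n ^ (k ∸ t) * n ^ t ≡ n ^ k
  n^[k∸t]*n^t≡n^k = trans (sym (^-distribˡ-+-* n (k ∸ t) t)) (cong (n ^_) (m∸n+n≡m t≤k))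

^-monoʳ-≤′ : ∀ m {a b} → 0 < a → a ≤ b → m ^ a ≤ m ^ b
^-monoʳ-≤′ zero {suc a} {suc b} _ _ = z≤n
^-monoʳ-≤′ (suc m) _ a≤b = ^-monoʳ-≤ (suc m) a≤b

theorem1p2 : (k p q : ℕ) →
    ((n : ℕ) (𝓕 : Family n) → IsUniform k 𝓕 → Intersecting 𝓕 →
       τ 𝓕 ≤ q → p + q ≤ n → β p q 𝓕 ≡ 0)
    × (∃[ C ] ∃[ N ] ((n : ℕ) → N ≤ n → (𝓕 : Family n) → IsUniform k 𝓕 → Intersecting 𝓕 →
       τ 𝓕 > q → β p q 𝓕 * n ^ (p + τ 𝓕) ≤ C * n ^ k))
theorem1p2 k p q =
  (λ n 𝓕 _ intersecting → β≡0 𝓕 intersecting) ,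
  (2 * k) ^ p * k ^ k , 2 * (p + q) , bound
  where
  bound : (n : ℕ) → 2 * (p + q) ≤ n → (𝓕 : Family n) → IsUniform k 𝓕 → Intersecting 𝓕 →
          τ 𝓕 > q → β p q 𝓕 * n ^ (p + τ 𝓕) ≤ (2 * k) ^ p * k ^ k * n ^ k
  bound n 2[p+q]≤n 𝓕 uniform intersecting q<τ = begin
    β p q 𝓕 * n ^ (p + τ 𝓕)              ≤⟨ β*n^[p+τ]≤ 𝓕 p uniform intersecting 2[p+q]≤n ⟩
    (2 * k) ^ p * k ^ τ 𝓕 * n ^ k        ≤⟨ *-monoˡ-≤ (n ^ k) (*-monoʳ-≤ ((2 * k) ^ p) k^τ≤k^k) ⟩
    (2 * k) ^ p * k ^ k * n ^ k          ∎
    where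
    open ≤-Reasoning
    k^τ≤k^k : k ^ τ 𝓕 ≤ k ^ k
    k^τ≤k^k = ^-monoʳ-≤′ k (≤-<-trans z≤n q<τ) (τ≤k 𝓕 uniform intersecting)
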